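{- Let $H=(V,\mathcal{E})$ be an acyclic hypergraph and $G$ its union join graph. For any distinct $E_i,E_j\in\mathcal{E}$, the following are equivalent: (i) $E_iE_j$ is an edge of $G$; (ii) $H$ has a join tree with the edge $E_iE_j$; (iii) each join tree $T$ of $H$ has an edge $E_i'E_j'$ on the path from $E_i$ to $E_j$ in $T$ such that $E_i\cap E_j=E_i'\cap E_j'$; (iv) each join tree $T$ of $H$ has a separator $S$ on the path $P_{ij}$ from $E_i$ to $E_j$ in $T$ with $S\subseteq S_i$ and $S\subseteq S_j$, where $S_i$ and $S_j$ are the separators on $P_{ij}$ which are closest to $E_i$ and $E_j$, respectively; (v) $E_i\cap E_j$ separates $E_i\setminus E_j$ from $E_j\setminus E_i$.
   Context: A hypergraph $H=(V,\mathcal{E})$ consists of a finite vertex set and a family of nonempty subsets (hyperedges); distinct hyperedges may be equal as sets; its incidence graph is assumed connected. A join tree for $H$ is a tree whose nodes are the hyperedges such that, for every vertex $v$, the hyperedges containing $v$ induce a connected subtree; $H$ is acyclic if it has a join tree. The union join graph $G$ has the hyperedges as vertices, two adjacent iff adjacent in some join tree. For a join tree $T$, the separator of an edge $XY$ of $T$ is $X\cap Y$; "separators on a path" are the separators of the edges of that path (the separator closest to $E_i$ is that of the edge of $P_{ij}$ incident to $E_i$). A sequence $\langle v_1,\dots,v_k\rangle$ of vertices forms a path in $H$ if for each $1\le p<k$ some hyperedge contains both $v_p$ and $v_{p+1}$. For vertex sets $X,Y,Z$, $X$ separates $Y$ from $Z$ if $X\neq\emptyset$ and every sequence of vertices forming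 a path in $H$ from a vertex of $Y$ to a vertex of $Z$ contains a vertex of $X$. -}

module Defs where

open import Data.Nat using (ℕ; zero; suc; _+_)
open import Data.Fin using (Fin; zero; suc; fromℕ; inject₁)
open import Data.Fin.Subset using (Subset; _∈_; _∩_; _─_; _⊆_; Nonempty)
open import Data.Bool using (Bool; true; false)
open import Data.Sum using (_⊎_; inj₁; inj₂)
open import Data.Product using (Σ; ∃; _×_; _,_)
open import Data.Empty using (⊥)
open import Relation.Nullary using (¬_)
open import Relation.Binary.PropositionalEquality using (_≡_; _≢_)
open import Function.Definitions using (Injective)
open import Function.Bundles using (_⇔_)

-- Walks / sequences.  A sequence with k steps is a map Fin (suc k) → A,
-- position 0 is the start and position (fromℕ k) is the end.

Consecutive : {A : Set} → (A → A → Set) → {k : ℕ} → (Fin (suc k) → A) → Set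
Consecutive R {k} p = (t : Fin k) → R (p (inject₁ t)) (p (suc t))

-- Hypergraphs: vertices Fin n, hyperedges indexed by Fin m (so distinct
-- hyperedges may coincide as sets), each a nonempty subset of vertices.

IncAdj : {n m : ℕ} → (Fin m → Subset n) → (Fin n ⊎ Fin m) → (Fin n ⊎ Fin m) → Set
IncAdj E (inj₁ v) (inj₂ e) = v ∈ E e
IncAdj E (inj₂ e) (inj₁ v) = v ∈ E e
IncAdj E (inj₁ _) (inj₁ _) = ⊥
IncAdj E (inj₂ _) (inj₂ _) = ⊥

ConnectedRel : {A : Set} → (A → A → Set) → Set
ConnectedRel {A} R = (a b : A) → Σ ℕ λ k → Σ (Fin (suc k) → A) λ p →
  p zero ≡ a × p (fromℕ k) ≡ b × Consecutive R p

record Hypergraph (n m : ℕ) : Set where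
  field
    E         : Fin m → Subset n
    nonempty  : (e : Fin m) → Nonempty (E e)
    connected : ConnectedRel (IncAdj E)

record Graph (m : ℕ) : Set where
  field
    adj   : Fin m → Fin m → Bool
    sym   : (a b : Fin m) → adj a b ≡ adj b a
    irrefl : (a : Fin m) → adj a a ≡ false

module _ {m : ℕ} (T : Graph m) where
  open Graph T

  Adj : Fin m → Fin m → Set
  Adj a b = adj a b ≡ true

  Walk : Fin m → Fin m → (k : ℕ) → (Fin (suc k) → Fin m) → Set
  Walk a b k p = p zero ≡ a × p (fromℕ k) ≡ b × Consecutive Adj p

  GPath : Fin m → Fin m → (k : ℕ) → (Fin (suc k) → Fin m) → Set
  GPath a b k p = Walk a b k p × Injective _≡_ _≡_ p

  Connected : Set
  Connected = ConnectedRel Adj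

  Cycle : (k : ℕ) → (Fin (suc (suc (suc k))) → Fin m) → Set
  Cycle k c = Injective _≡_ _≡_ c × Consecutive Adj c × Adj (c (fromℕ (suc (suc k)))) (c zero)

  Acyclic : Set
  Acyclic = (k : ℕ) (c : Fin (suc (suc (suc k))) → Fin m) → ¬ Cycle k c

  IsTree : Set
  IsTree = Connected × Acyclic

module _ {n m : ℕ} (H : Hypergraph n m) where
  open Hypergraph H

  IsJoinTree : Graph m → Set
  IsJoinTree T = IsTree T × ((v : Fin n) (a b : Fin m) → v ∈ E a → v ∈ E b →
    Σ ℕ λ k → Σ (Fin (suc k) → Fin m) λ p → Walk T a b k p × ((t : Fin (suc k)) → v ∈ E (p t)))

  HAcyclic : Set
  HAcyclic = Σ (Graph m) IsJoinTree

  UnionJoinAdj : Fin m → Fin m → Set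
  UnionJoinAdj a b = Σ (Graph m) λ T → IsJoinTree T × Adj T a b

  sepAt : {k : ℕ} → (Fin (suc k) → Fin m) → Fin k → Subset n
  sepAt p t = E (p (inject₁ t)) ∩ E (p (suc t))

  HPath : {k : ℕ} → (Fin (suc k) → Fin n) → Set
  HPath = Consecutive (λ u w → ∃ λ e → u ∈ E e × w ∈ E e)

  Separates : Subset n → Subset n → Subset n → Set
  Separates X Y Z = Nonempty X × ((k : ℕ) (p : Fin (suc k) → Fin n) →
    p zero ∈ Y → p (fromℕ k) ∈ Z → HPath p → ∃ λ t → p t ∈ X)

  Cond-i Cond-ii Cond-iii Cond-iv Cond-v : Fin m → Fin m → Set
  Cond-i i j = UnionJoinAdj i j
  Cond-ii i j = Σ (Graph m) λ T → IsJoinTree T × Adj T i j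
  Cond-iii i j = (T : Graph m) → IsJoinTree T → (k : ℕ) (p : Fin (suc k) → Fin m) →
    GPath T i j k p → ∃ λ (t : Fin k) → E i ∩ E j ≡ sepAt p t
  -- since i ≢ j, the path has at least one edge, i.e. suc k edges;
  -- S_i = sepAt p zero, S_j = sepAt p (fromℕ k)
  Cond-iv i j = (T : Graph m) → IsJoinTree T → (k : ℕ) (p : Fin (suc (suc k)) → Fin m) →
    GPath T i j (suc k) p →
    ∃ λ (t : Fin (suc k)) → sepAt p t ⊆ sepAt p zero × sepAt p t ⊆ sepAt p (fromℕ k)
  Cond-v i j = Separates (E i ∩ E j) (E i ─ E j) (E j ─ E i)

{-# OPTIONS --safe #-}
-- (ii) ⇒ (v): if E_i E_j is an edge of a join tree T, a path of H avoiding
-- E_i ∩ E_j links E_i to E_j through hyperedges sharing vertices outside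
-- E_i ∩ E_j; since the hyperedges containing a vertex span a subtree, this
-- gives a walk in T from E_i to E_j avoiding the edge E_i E_j, impossible in
-- a tree.  (v) ⇒ (iii): every separator on the tree path P_ij contains
-- E_i ∩ E_j; if none equals it, picking a vertex outside E_i ∩ E_j in each
-- separator yields a path of H from E_i ∖ E_j to E_j ∖ E_i missing E_i ∩ E_j.
-- (iii) ⇒ (ii): exchanging the path edge E_i' E_j' for E_i E_j keeps a join
-- tree, because every vertex of E_i' ∩ E_j' = E_i ∩ E_j lies in all
-- hyperedges of P_ij, so subtrees through E_i' E_j' can be rerouted along
-- P_ij and E_i E_j.  (iii) ⇔ (iv) as all separators on P_ij contain
-- E_i ∩ E_j, and (i) is (ii) by definition.
module Submission where

open import Defs
open import Data.Nat using (ℕ; zero; suc)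
open import Data.Fin using (Fin; zero; suc; fromℕ; inject₁)
open import Data.Fin.Properties using (any?; suc-injective; inject₁-injective; 0≢1+n)
  renaming (_≟_ to _≟ᶠ_)
open import Data.Fin.Subset using (Subset; _∈_; _∉_; _∩_; _─_; _⊆_; _⊈_; Nonempty)
open import Data.Fin.Subset.Properties
  using (_∈?_; _⊆?_; nonempty?; ⊆-antisym; ⊆-trans; ⊆-reflexive; x∈p∩q⁺; x∈p∩q⁻; x∈p∧x∉q⇒x∈p─q; p─q⊆p)
open import Data.Bool using (Bool; true; false)
open import Data.Sum using (_⊎_; inj₁; inj₂)
import Data.Sum as Sum
open import Data.Product using (Σ; ∃; _×_; _,_; proj₁; proj₂; map₂)
open import Data.Empty using (⊥; ⊥-elim)
open import Data.Unit using (⊤; tt)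
open import Function using (_∘_; id; const)
open import Function.Definitions using (Injective)
open import Function.Bundles using (_⇔_; mk⇔)
open import Relation.Nullary using (¬_; Dec; yes; no; ¬?; contradiction)
open import Relation.Nullary.Decidable using (_×-dec_; _⊎-dec_)
open import Relation.Binary.Definitions using (DecidableEquality)
open import Relation.Binary.PropositionalEquality using (_≡_; _≢_; refl; sym; trans; cong; subst; subst₂)
open import Relation.Binary.Construct.Closure.ReflexiveTransitive as Star
  using (Star; ε; _◅_; _◅◅_; _⋆; reverse)

x∈p∧x∉p∩q⇒x∈p─q : ∀ {n} {p q : Subset n} {x} → x ∈ p → x ∉ p ∩ q → x ∈ p ─ q
x∈p∧x∉p∩q⇒x∈p─q x∈p x∉p∩q = x∈p∧x∉q⇒x∈p─q x∈p (λ x∈q → x∉p∩q (x∈p∩q⁺ (x∈p , x∈q)))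

x∈q∧x∉p∩q⇒x∈q─p : ∀ {n} {p q : Subset n} {x} → x ∈ q → x ∉ p ∩ q → x ∈ q ─ p
x∈q∧x∉p∩q⇒x∈q─p x∈q x∉p∩q = x∈p∧x∉q⇒x∈p─q x∈q (λ x∈p → x∉p∩q (x∈p∩q⁺ (x∈p , x∈q)))

p⊈q⇒∃x∈p∧x∉q : ∀ {n} {p q : Subset n} → p ⊈ q → ∃ λ x → x ∈ p × x ∉ q
p⊈q⇒∃x∈p∧x∉q {p = p} {q} p⊈q with any? (λ x → x ∈? p ×-dec ¬? (x ∈? q))
... | yes witness = witness
... | no none = ⊥-elim (p⊈q p⊆q)
  where
  p⊆q : p ⊆ q
  p⊆q {x} x∈p with x ∈? q
  ... | yes x∈q = x∈q
  ... | no x∉q = contradiction (x , x∈p , x∉q) none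

Sequence : {A : Set} → (A → A → Set) → A → A → Set
Sequence {A} R a b = Σ ℕ λ k → Σ (Fin (suc k) → A) λ p → p zero ≡ a × p (fromℕ k) ≡ b × Consecutive R p

module _ {A : Set} {R : A → A → Set} where

  length : ∀ {a b} → Star R a b → ℕ
  length ε       = 0
  length (_ ◅ w) = suc (length w)

  at : ∀ {a b} (w : Star R a b) → Fin (suc (length w)) → A
  at {a} _       zero    = a
  at     (_ ◅ w) (suc t) = at w t

  at-last : ∀ {a b} (w : Star R a b) → at w (fromℕ (length w)) ≡ b
  at-last ε       = refl
  at-last (_ ◅ w) = at-last w

  at-consecutive : ∀ {a b} (w : Star R a b) → Consecutive R (at w)
  at-consecutive (r ◅ _) zero    = r
  at-consecutive (_ ◅ w) (suc t) = at-consecutive w t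

  toSequence : ∀ {a b} → Star R a b → Sequence R a b
  toSequence w = length w , at w , refl , at-last w , at-consecutive w

  fromConsecutive : ∀ {k} (p : Fin (suc k) → A) → Consecutive R p → Star R (p zero) (p (fromℕ k))
  fromConsecutive {zero}  p c = ε
  fromConsecutive {suc k} p c = c zero ◅ fromConsecutive (p ∘ suc) (c ∘ suc)

  fromSequence : ∀ {a b} → Sequence R a b → Star R a b
  fromSequence (_ , p , refl , refl , c) = fromConsecutive p c

  initialWalk : ∀ {k} (p : Fin (suc k) → A) (t : Fin k) →
    (∀ s → s ≢ t → R (p (inject₁ s)) (p (suc s))) → Star R (p zero) (p (inject₁ t))
  initialWalk p zero    edge = ε
  initialWalk p (suc t) edge =
    edge zero (λ ()) ◅ initialWalk (p ∘ suc) t (λ s s≢t → edge (suc s) (s≢t ∘ suc-injective))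

  finalWalk : ∀ {k} (p : Fin (suc k) → A) (t : Fin k) →
    (∀ s → s ≢ t → R (p (inject₁ s)) (p (suc s))) → Star R (p (suc t)) (p (fromℕ k))
  finalWalk p zero    edge = fromConsecutive (p ∘ suc) (λ s → edge (suc s) (λ ()))
  finalWalk p (suc t) edge = finalWalk (p ∘ suc) t (λ s s≢t → edge (suc s) (s≢t ∘ suc-injective))

  Simple : ∀ {a b} → Star R a b → Set
  Simple ε           = ⊤
  Simple {a} (_ ◅ w) = (∀ t → at w t ≢ a) × Simple w

  Simple⇒injective : ∀ {a b} (w : Star R a b) → Simple w → Injective _≡_ _≡_ (at w)
  Simple⇒injective _       _         {zero}  {zero}  _ = refl
  Simple⇒injective (_ ◅ w) (a∉w , _) {zero}  {suc y} e = contradiction (sym e) (a∉w y)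
  Simple⇒injective (_ ◅ w) (a∉w , _) {suc x} {zero}  e = contradiction e (a∉w x)
  Simple⇒injective (_ ◅ w) (_ , s)   {suc x} {suc y} e =
    cong suc (Simple⇒injective w s e)

  dropUntil : ∀ {a b} (w : Star R a b) → Simple w → (t : Fin (suc (length w))) →
    Σ (Star R (at w t) b) Simple
  dropUntil w       s       zero    = w , s
  dropUntil (_ ◅ w) (_ , s) (suc t) = dropUntil w s t

  toSimple : DecidableEquality A → ∀ {a b} → Star R a b → Σ (Star R a b) Simple
  toSimple _≟_ ε = ε , tt
  toSimple _≟_ {a} (r ◅ w) with toSimple _≟_ w
  ... | w′ , s′ with any? (λ t → at w′ t ≟ a)
  ... | yes (t , w′ₜ≡a) = subst (λ c → Σ (Star R c _) Simple) w′ₜ≡a (dropUntil w′ s′ t)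
  ... | no a∉w′ = (r ◅ w′) , (λ t e → a∉w′ (t , e)) , s′

Within : {A : Set} → (A → Set) → (A → A → Set) → A → A → Set
Within Q R a b = R a b × Q a × Q b

SequenceWithin : {A : Set} → (A → Set) → (A → A → Set) → A → A → Set
SequenceWithin {A} Q R a b = Σ ℕ λ k → Σ (Fin (suc k) → A) λ p →
  (p zero ≡ a × p (fromℕ k) ≡ b × Consecutive R p) × (∀ t → Q (p t))

module _ {A : Set} {R : A → A → Set} {Q : A → Set} where

  at-within : ∀ {a b} → Q a → (w : Star (Within Q R) a b) → ∀ t → Q (at w t)
  at-within qa _                  zero    = qa
  at-within _  ((_ , _ , qb) ◅ w) (suc t) = at-within qb w t

  fromSequenceWithin : ∀ {a b} → SequenceWithin Q R a b → Star (Within Q R) a b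
  fromSequenceWithin (k , p , (p₀ , pₗ , c) , q) =
    fromSequence (k , p , p₀ , pₗ , λ s → c s , q (inject₁ s) , q (suc s))

  toSequenceWithin : ∀ {a b} → Q a → Star (Within Q R) a b → SequenceWithin Q R a b
  toSequenceWithin qa w =
    length w , at w , (refl , at-last w , proj₁ ∘ at-consecutive w) , at-within qa w

edge-crossing : ∀ {k} {s t : Fin k} → inject₁ s ≡ suc t → suc s ≢ inject₁ t
edge-crossing {s = suc s} {suc t} e₁ e₂ = edge-crossing (suc-injective e₁) (suc-injective e₂)

module _ {A : Set} where

  SameEdge : A → A → A → A → Set
  SameEdge x y a b = (a ≡ x × b ≡ y) ⊎ (a ≡ y × b ≡ x)

  sameEdge? : DecidableEquality A → ∀ x y a b → Dec (SameEdge x y a b)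
  sameEdge? _≟_ x y a b = ((a ≟ x) ×-dec (b ≟ y)) ⊎-dec ((a ≟ y) ×-dec (b ≟ x))

  SameEdge-flip : ∀ {x y a b} → SameEdge x y a b → SameEdge x y b a
  SameEdge-flip (inj₁ (a≡x , b≡y)) = inj₂ (b≡y , a≡x)
  SameEdge-flip (inj₂ (a≡y , b≡x)) = inj₁ (b≡x , a≡y)

  SameEdge-sym : ∀ {x y a b} → SameEdge x y a b → SameEdge a b x y
  SameEdge-sym (inj₁ (refl , refl)) = inj₁ (refl , refl)
  SameEdge-sym (inj₂ (refl , refl)) = inj₂ (refl , refl)

  SameEdge-trans : ∀ {x y a b c d} → SameEdge x y a b → SameEdge a b c d → SameEdge x y c d
  SameEdge-trans (inj₁ (refl , refl)) e = e
  SameEdge-trans (inj₂ (refl , refl)) e = Sum.swap e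

  SameEdge-loop : ∀ {x y a} → SameEdge x y a a → x ≡ y
  SameEdge-loop (inj₁ (a≡x , a≡y)) = trans (sym a≡x) a≡y
  SameEdge-loop (inj₂ (a≡y , a≡x)) = trans (sym a≡x) a≡y

  SameEdge-both : ∀ {P : A → Set} {x y a b} → SameEdge x y a b → P a → P b → P x × P y
  SameEdge-both (inj₁ (refl , refl)) pa pb = pa , pb
  SameEdge-both (inj₂ (refl , refl)) pa pb = pb , pa

  injective⇒distinctEdges : ∀ {k} (p : Fin (suc k) → A) → Injective _≡_ _≡_ p → ∀ {s t} → s ≢ t →
    ¬ SameEdge (p (inject₁ t)) (p (suc t)) (p (inject₁ s)) (p (suc s))
  injective⇒distinctEdges p inj s≢t (inj₁ (e , _))   = s≢t (inject₁-injective (inj e))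
  injective⇒distinctEdges p inj _   (inj₂ (e₁ , e₂)) = edge-crossing (inj e₁) (inj e₂)

  -- false for two vertices, where the closing edge repeats the only other edge
  injective⇒closingEdgeDistinct : ∀ {k} (c : Fin (suc (suc (suc k))) → A) → Injective _≡_ _≡_ c →
    ∀ s → ¬ SameEdge (c (fromℕ (suc (suc k)))) (c zero) (c (inject₁ s)) (c (suc s))
  injective⇒closingEdgeDistinct c inj s       (inj₁ (_ , e)) = 0≢1+n (sym (inj e))
  injective⇒closingEdgeDistinct c inj zero    (inj₂ (_ , e)) = 0≢1+n (suc-injective (inj e))
  injective⇒closingEdgeDistinct c inj (suc s) (inj₂ (e , _)) = 0≢1+n (sym (inj e))

module _ {m : ℕ} (T : Graph m) where

  Adj-sym : ∀ {a b} → Adj T a b → Adj T b a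
  Adj-sym {a} {b} e = trans (Graph.sym T b a) e

  Adj-irrefl : ∀ {a} → ¬ Adj T a a
  Adj-irrefl {a} e = contradiction (trans (sym e) (Graph.irrefl T a)) λ ()

  AdjAvoiding : Fin m → Fin m → Fin m → Fin m → Set
  AdjAvoiding x y a b = Adj T a b × ¬ SameEdge x y a b

  AdjAvoiding-sym : ∀ {x y a b} → AdjAvoiding x y a b → AdjAvoiding x y b a
  AdjAvoiding-sym (e , ¬xy) = Adj-sym e , ¬xy ∘ SameEdge-flip

  connected⇒GPath : Connected T → ∀ a b → Σ ℕ λ k → Σ (Fin (suc k) → Fin m) (GPath T a b k)
  connected⇒GPath conn a b with toSimple {R = Adj T} _≟ᶠ_ (fromSequence (conn a b))
  ... | w , simple = length w , at w , (refl , at-last w , at-consecutive w) , Simple⇒injective w simple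

  acyclic⇒bridge : Acyclic T → ∀ {x y} → Adj T x y → ¬ Star (AdjAvoiding x y) x y
  acyclic⇒bridge acyclic xy w with toSimple _≟ᶠ_ w
  ... | ε , _ = Adj-irrefl xy
  ... | (r ◅ ε) , _ = proj₂ r (inj₁ (refl , refl))
  ... | w′@(_ ◅ _ ◅ w″) , simple = acyclic (length w″) (at w′)
    ( Simple⇒injective w′ simple
    , proj₁ ∘ at-consecutive w′
    , subst (λ z → Adj T z _) (sym (at-last w′)) (Adj-sym xy) )

  acyclic⇒pathBridge : Acyclic T → ∀ {k} (p : Fin (suc k) → Fin m) → Injective _≡_ _≡_ p →
    Consecutive (Adj T) p → (t : Fin k) →
    ¬ Star (AdjAvoiding (p (inject₁ t)) (p (suc t))) (p zero) (p (fromℕ k))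
  acyclic⇒pathBridge acyclic p inj c t w = acyclic⇒bridge acyclic (c t)
    (reverse AdjAvoiding-sym (initialWalk p t other) ◅◅ w ◅◅ reverse AdjAvoiding-sym (finalWalk p t other))
    where
    other : ∀ s → s ≢ t → AdjAvoiding (p (inject₁ t)) (p (suc t)) (p (inject₁ s)) (p (suc s))
    other s s≢t = c s , injective⇒distinctEdges p inj s≢t

  cycle⇒closingBypass : ∀ {k c} → Cycle T k c →
    Star (AdjAvoiding (c (fromℕ (suc (suc k)))) (c zero)) (c zero) (c (fromℕ (suc (suc k))))
  cycle⇒closingBypass {c = c} (inj , cons , _) =
    fromConsecutive c (λ s → cons s , injective⇒closingEdgeDistinct c inj s)

  cycle⇒edgeBypass : ∀ {k c} → Cycle T k c → (s : Fin (suc (suc k))) →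
    Star (AdjAvoiding (c (inject₁ s)) (c (suc s))) (c (suc s)) (c (inject₁ s))
  cycle⇒edgeBypass {c = c} (inj , cons , closing) s =
    finalWalk c s other
      ◅◅ (closing , injective⇒closingEdgeDistinct c inj s ∘ SameEdge-sym)
      ◅ initialWalk c s other
    where
    other : ∀ s′ → s′ ≢ s → AdjAvoiding (c (inject₁ s)) (c (suc s)) (c (inject₁ s′)) (c (suc s′))
    other s′ s′≢s = cons s′ , injective⇒distinctEdges c inj s′≢s

module _ {n m : ℕ} (H : Hypergraph n m) where
  open Hypergraph H

  separators⇒HPath : ∀ {k} (p : Fin (suc (suc k)) → Fin m) (w : Fin (suc k) → Fin n) →
    (∀ s → w s ∈ sepAt H p s) → HPath H w
  separators⇒HPath p w w∈S s =
    p (suc (inject₁ s)) , proj₂ (x∈p∩q⁻ _ _ (w∈S (inject₁ s))) , proj₁ (x∈p∩q⁻ _ _ (w∈S (suc s)))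

  Linked : Subset n → Fin m → Fin m → Set
  Linked X a b = ∃ λ x → x ∉ X × x ∈ E a × x ∈ E b

  incidence⇒linked : ∀ {X a b} → (∀ x → x ∉ X) →
    Star (IncAdj E) (inj₂ a) (inj₂ b) → Star (Linked X) a b
  incidence⇒linked _ ε = ε
  incidence⇒linked none (_◅_ {j = inj₁ x} x∈a (_◅_ {j = inj₂ _} x∈c w)) =
    (x , none x , x∈a , x∈c) ◅ incidence⇒linked none w

  HPath⇒linked : ∀ {X k} (q : Fin (suc k) → Fin n) → HPath H q → (∀ t → q t ∉ X) →
    ∀ {a b} → q zero ∈ E a → q (fromℕ k) ∈ E b → Star (Linked X) a b
  HPath⇒linked {k = zero}  q _  q∉X q∈a q∈b = (q zero , q∉X zero , q∈a , q∈b) ◅ ε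
  HPath⇒linked {k = suc k} q hp q∉X q∈a q∈b with hp zero
  ... | _ , q₀∈e , q₁∈e =
    (q zero , q∉X zero , q∈a , q₀∈e) ◅ HPath⇒linked (q ∘ suc) (hp ∘ suc) (q∉X ∘ suc) q₁∈e q∈b

module JoinTree {n m : ℕ} (H : Hypergraph n m) (T : Graph m) (jt : IsJoinTree H T) where
  open Hypergraph H

  acyclic : Acyclic T
  acyclic = proj₂ (proj₁ jt)

  join-walk : ∀ {x a b} → x ∈ E a → x ∈ E b → Star (Within (λ e → x ∈ E e) (Adj T)) a b
  join-walk {x} {a} {b} x∈a x∈b = fromSequenceWithin (proj₂ jt x a b x∈a x∈b)

  join-walk-avoiding : ∀ {x a b c d} → x ∉ E c ∩ E d → x ∈ E a → x ∈ E b → Star (AdjAvoiding T c d) a b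
  join-walk-avoiding x∉cd x∈a x∈b =
    Star.map (λ (e , x∈e , x∈e′) → e , λ same → x∉cd (x∈p∩q⁺ (SameEdge-both same x∈e x∈e′)))
      (join-walk x∈a x∈b)

  ∩⊆sepAt : ∀ {i j k p} → GPath T i j k p → (s : Fin k) → E i ∩ E j ⊆ sepAt H p s
  ∩⊆sepAt {p = p} ((refl , refl , c) , inj) s {x} x∈ij with x ∈? sepAt H p s
  ... | yes x∈S = x∈S
  ... | no x∉S = contradiction
    (join-walk-avoiding x∉S (proj₁ (x∈p∩q⁻ _ _ x∈ij)) (proj₂ (x∈p∩q⁻ _ _ x∈ij)))
    (acyclic⇒pathBridge T acyclic p inj c s)

  ∩⊆path : ∀ {i j k p x} → GPath T i j k p → x ∈ E i ∩ E j → ∀ t → x ∈ E (p t)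
  ∩⊆path {x = x} ((p₀ , _) , _) x∈ij zero = subst (λ e → x ∈ E e) (sym p₀) (proj₁ (x∈p∩q⁻ _ _ x∈ij))
  ∩⊆path gp x∈ij (suc s) = proj₂ (x∈p∩q⁻ _ _ (∩⊆sepAt gp s x∈ij))

  edge⇒¬linked : ∀ {i j} → Adj T i j → ¬ Star (Linked H (E i ∩ E j)) i j
  edge⇒¬linked ij links = acyclic⇒bridge T acyclic ij ((bypass ⋆) links)
    where
    bypass : ∀ {a b} → Linked H _ a b → Star (AdjAvoiding T _ _) a b
    bypass (_ , x∉ij , x∈a , x∈b) = join-walk-avoiding x∉ij x∈a x∈b

module EdgeExchange {n m : ℕ} (H : Hypergraph n m) (T : Graph m) (jt : IsJoinTree H T)
  {i j : Fin m} (i≢j : i ≢ j) {k : ℕ} {p : Fin (suc k) → Fin m} (gp : GPath T i j k p)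
  (t : Fin k) (i∩j≡sep : Hypergraph.E H i ∩ Hypergraph.E H j ≡ sepAt H p t) where
  open Hypergraph H
  open JoinTree H T jt

  u v : Fin m
  u = p (inject₁ t)
  v = p (suc t)

  adj′ : Fin m → Fin m → Bool
  adj′ a b with sameEdge? _≟ᶠ_ i j a b | sameEdge? _≟ᶠ_ u v a b
  ... | yes _ | _     = true
  ... | no _  | yes _ = false
  ... | no _  | no _  = Graph.adj T a b

  adj′-sym : ∀ a b → adj′ a b ≡ adj′ b a
  adj′-sym a b with sameEdge? _≟ᶠ_ i j a b | sameEdge? _≟ᶠ_ u v a b
                  | sameEdge? _≟ᶠ_ i j b a | sameEdge? _≟ᶠ_ u v b a
  ... | yes _  | _      | yes _  | _      = refl
  ... | yes ij | _      | no ¬ij | _      = contradiction (SameEdge-flip ij) ¬ij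
  ... | no ¬ij | _      | yes ij | _      = contradiction (SameEdge-flip ij) ¬ij
  ... | no _   | yes _  | no _   | yes _  = refl
  ... | no _   | yes uv | no _   | no ¬uv = contradiction (SameEdge-flip uv) ¬uv
  ... | no _   | no ¬uv | no _   | yes uv = contradiction (SameEdge-flip uv) ¬uv
  ... | no _   | no _   | no _   | no _   = Graph.sym T a b

  adj′-irrefl : ∀ a → adj′ a a ≡ false
  adj′-irrefl a with sameEdge? _≟ᶠ_ i j a a | sameEdge? _≟ᶠ_ u v a a
  ... | yes ij | _     = contradiction (SameEdge-loop ij) i≢j
  ... | no _   | yes _ = refl
  ... | no _   | no _  = Graph.irrefl T a

  T′ : Graph m
  T′ = record { adj = adj′ ; sym = adj′-sym ; irrefl = adj′-irrefl }

  ij∈T′ : Adj T′ i j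
  ij∈T′ with sameEdge? _≟ᶠ_ i j i j | sameEdge? _≟ᶠ_ u v i j
  ... | yes _  | _ = refl
  ... | no ¬ij | _ = contradiction (inj₁ (refl , refl)) ¬ij

  T⇒T′ : ∀ {a b} → AdjAvoiding T u v a b → Adj T′ a b
  T⇒T′ {a} {b} (e , ¬uv) with sameEdge? _≟ᶠ_ i j a b | sameEdge? _≟ᶠ_ u v a b
  ... | yes _ | _      = refl
  ... | no _  | yes uv = contradiction uv ¬uv
  ... | no _  | no _   = e

  T′⇒T : ∀ {a b} → AdjAvoiding T′ i j a b → AdjAvoiding T u v a b
  T′⇒T {a} {b} (e , ¬ij) with sameEdge? _≟ᶠ_ i j a b | sameEdge? _≟ᶠ_ u v a b
  ... | yes ij | _      = contradiction ij ¬ij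
  ... | no _   | yes _  = contradiction e λ ()
  ... | no _   | no ¬uv = e , ¬uv

  p-inj : Injective _≡_ _≡_ p
  p-inj = proj₂ gp

  p-cons : Consecutive (Adj T) p
  p-cons = proj₂ (proj₂ (proj₁ gp))

  onEnds : ∀ {R : Fin m → Fin m → Set} → R i j → R (p zero) (p (fromℕ k))
  onEnds = subst₂ _ (sym (proj₁ (proj₁ gp))) (sym (proj₁ (proj₂ (proj₁ gp))))

  no-ij-bypass : ∀ {a b} → SameEdge i j a b → ¬ Star (AdjAvoiding T′ a b) b a
  no-ij-bypass same w = oriented same (Star.map (map₂ (_∘ SameEdge-trans (SameEdge-sym same))) w)
    where
    oriented : ∀ {a b} → SameEdge i j a b → Star (AdjAvoiding T′ i j) b a → ⊥
    oriented (inj₁ (refl , refl)) w = oriented (inj₂ (refl , refl)) (reverse (AdjAvoiding-sym T′) w)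
    oriented (inj₂ (refl , refl)) w = acyclic⇒pathBridge T acyclic p p-inj p-cons t (onEnds (Star.map T′⇒T w))

  T′-acyclic : Acyclic T′
  T′-acyclic k c cycle@(inj , cons , closing) =
    cases (any? (λ s → sameEdge? _≟ᶠ_ i j (c (inject₁ s)) (c (suc s))))
          (sameEdge? _≟ᶠ_ i j (c (fromℕ (suc (suc k)))) (c zero))
    where
    cases : Dec (∃ λ s → SameEdge i j (c (inject₁ s)) (c (suc s))) →
            Dec (SameEdge i j (c (fromℕ (suc (suc k)))) (c zero)) → ⊥
    cases (yes (s , ij)) _            = no-ij-bypass ij (cycle⇒edgeBypass T′ cycle s)
    cases (no _)         (yes ij)     = no-ij-bypass ij (cycle⇒closingBypass T′ cycle)
    cases (no ¬inner)    (no ¬closing) = acyclic k c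
      (inj , (λ s → proj₁ (T′⇒T (cons s , λ ij → ¬inner (s , ij)))) , proj₁ (T′⇒T (closing , ¬closing)))

  module Reroute (Q : Fin m → Set) (Q-path : Q u → Q v → ∀ s → Q (p s)) where

    flip : ∀ {a b} → Within Q (Adj T′) a b → Within Q (Adj T′) b a
    flip {a} {b} (e , qa , qb) = Adj-sym T′ {a} {b} e , qb , qa

    detour : Q u → Q v → Star (Within Q (Adj T′)) u v
    detour qu qv =
      reverse flip (initialWalk p t step)
        ◅◅ (onEnds {Adj T′} ij∈T′ , q zero , q (fromℕ k)) ◅ reverse flip (finalWalk p t step)
      where
      q : ∀ s → Q (p s)
      q = Q-path qu qv
      step : ∀ s → s ≢ t → Within Q (Adj T′) (p (inject₁ s)) (p (suc s))
      step s s≢t = T⇒T′ (p-cons s , injective⇒distinctEdges p p-inj s≢t) , q (inject₁ s) , q (suc s)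

    reroute : ∀ {a b} → Within Q (Adj T) a b → Star (Within Q (Adj T′)) a b
    reroute {a} {b} (e , qa , qb) with sameEdge? _≟ᶠ_ u v a b
    ... | yes (inj₁ (refl , refl)) = detour qa qb
    ... | yes (inj₂ (refl , refl)) = reverse flip (detour qb qa)
    ... | no ¬uv                   = (T⇒T′ (e , ¬uv) , qa , qb) ◅ ε

  T′-connected : Connected T′
  T′-connected a b =
    toSequence (Star.map proj₁ ((Reroute.reroute (const ⊤) (λ _ _ _ → tt) ⋆)
      (Star.map (λ e → e , tt , tt) (fromSequence (proj₁ (proj₁ jt) a b)))))

  T′-subtrees : (x : Fin n) (a b : Fin m) → x ∈ E a → x ∈ E b → SequenceWithin (λ e → x ∈ E e) (Adj T′) a b
  T′-subtrees x a b x∈a x∈b =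
    toSequenceWithin x∈a ((Reroute.reroute (λ e → x ∈ E e) onPath ⋆) (join-walk x∈a x∈b))
    where
    onPath : x ∈ E u → x ∈ E v → ∀ s → x ∈ E (p s)
    onPath x∈u x∈v = ∩⊆path gp (subst (x ∈_) (sym i∩j≡sep) (x∈p∩q⁺ (x∈u , x∈v)))

  exchanged : Cond-ii H i j
  exchanged = T′ , ((T′-connected , T′-acyclic) , T′-subtrees) , ij∈T′

module _ {n m : ℕ} (H : Hypergraph n m) where
  open Hypergraph H

  ii⇒v : ∀ {i j} → Cond-ii H i j → Cond-v H i j
  ii⇒v {i} {j} (T , jt , ij) = i∩j-nonempty , separates
    where
    ¬linked : ¬ Star (Linked H (E i ∩ E j)) i j
    ¬linked = JoinTree.edge⇒¬linked H T jt ij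

    i∩j-nonempty : Nonempty (E i ∩ E j)
    i∩j-nonempty with nonempty? (E i ∩ E j)
    ... | yes ne = ne
    ... | no empty = contradiction
      (incidence⇒linked H (λ x x∈ → empty (x , x∈)) (fromSequence (connected (inj₂ i) (inj₂ j))))
      ¬linked

    separates : ∀ k q → q zero ∈ E i ─ E j → q (fromℕ k) ∈ E j ─ E i → HPath H q →
      ∃ λ t → q t ∈ E i ∩ E j
    separates k q q₀ qₗ hp with any? (λ t → q t ∈? E i ∩ E j)
    ... | yes hit = hit
    ... | no miss = contradiction
      (HPath⇒linked H q hp (λ t x → miss (t , x)) (p─q⊆p _ _ q₀) (p─q⊆p _ _ qₗ))
      ¬linked

  v⇒iii : ∀ {i j} → i ≢ j → Cond-v H i j → Cond-iii H i j
  v⇒iii i≢j _ T jt zero p ((p₀ , pₗ , _) , _) = contradiction (trans (sym p₀) pₗ) i≢j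
  v⇒iii {i} {j} _ (_ , separates) T jt (suc k) p gp@((refl , refl , _) , _)
    with any? (λ s → sepAt H p s ⊆? E i ∩ E j)
  ... | yes (s , S⊆X) = s , ⊆-antisym (JoinTree.∩⊆sepAt H T jt gp s) S⊆X
  ... | no none = contradiction (separates k w w₀ wₗ (separators⇒HPath H p w w∈S)) λ (s , w∈X) → w∉X s w∈X
    where
    choice : ∀ s → ∃ λ x → x ∈ sepAt H p s × x ∉ E i ∩ E j
    choice s = p⊈q⇒∃x∈p∧x∉q (λ S⊆X → none (s , S⊆X))
    w : Fin (suc k) → Fin n
    w = proj₁ ∘ choice
    w∈S : ∀ s → w s ∈ sepAt H p s
    w∈S = proj₁ ∘ proj₂ ∘ choice
    w∉X : ∀ s → w s ∉ E i ∩ E j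
    w∉X = proj₂ ∘ proj₂ ∘ choice
    w₀ : w zero ∈ E i ─ E j
    w₀ = x∈p∧x∉p∩q⇒x∈p─q (proj₁ (x∈p∩q⁻ _ _ (w∈S zero))) (w∉X zero)
    wₗ : w (fromℕ k) ∈ E j ─ E i
    wₗ = x∈q∧x∉p∩q⇒x∈q─p (proj₂ (x∈p∩q⁻ _ _ (w∈S (fromℕ k)))) (w∉X (fromℕ k))

  iii⇒iv : ∀ {i j} → Cond-iii H i j → Cond-iv H i j
  iii⇒iv iii T jt k p gp with iii T jt (suc k) p gp
  ... | t , X≡S = t , ⊆-trans (⊆-reflexive (sym X≡S)) (JoinTree.∩⊆sepAt H T jt gp zero)
                    , ⊆-trans (⊆-reflexive (sym X≡S)) (JoinTree.∩⊆sepAt H T jt gp (fromℕ k))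

  iv⇒iii : ∀ {i j} → i ≢ j → Cond-iv H i j → Cond-iii H i j
  iv⇒iii i≢j _ T jt zero p ((p₀ , pₗ , _) , _) = contradiction (trans (sym p₀) pₗ) i≢j
  iv⇒iii _ iv T jt (suc k) p gp@((refl , refl , _) , _) with iv T jt k p gp
  ... | t , S⊆S₀ , S⊆Sₗ = t , ⊆-antisym (JoinTree.∩⊆sepAt H T jt gp t)
    (λ x∈S → x∈p∩q⁺ (proj₁ (x∈p∩q⁻ _ _ (S⊆S₀ x∈S)) , proj₂ (x∈p∩q⁻ _ _ (S⊆Sₗ x∈S))))

  iii⇒ii : ∀ {i j} → i ≢ j → HAcyclic H → Cond-iii H i j → Cond-ii H i j
  iii⇒ii {i} {j} i≢j (T , jt) iii with connected⇒GPath T (proj₁ (proj₁ jt)) i j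
  ... | k , p , gp with iii T jt k p gp
  ... | t , X≡S = EdgeExchange.exchanged H T jt i≢j gp t X≡S

lemma3 : {n m : ℕ} (H : Hypergraph n m) → HAcyclic H → (i j : Fin m) → i ≢ j →
    (Cond-i H i j ⇔ Cond-ii H i j) × (Cond-i H i j ⇔ Cond-iii H i j) ×
    (Cond-i H i j ⇔ Cond-iv H i j) × (Cond-i H i j ⇔ Cond-v H i j)
lemma3 H acyclic i j i≢j =
  mk⇔ id id ,
  mk⇔ (v⇒iii H i≢j ∘ ii⇒v H) (iii⇒ii H i≢j acyclic) ,
  mk⇔ (iii⇒iv H ∘ v⇒iii H i≢j ∘ ii⇒v H) (iii⇒ii H i≢j acyclic ∘ iv⇒iii H i≢j) ,
  mk⇔ (ii⇒v H) (iii⇒ii H i≢j acyclic ∘ v⇒iii H i≢j)
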